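{- Let $s$ be a positive integer, $A$ a finitely generated abelian group and $B$ an $s$-extension of $A$. There is a canonical isomorphism \[ \varphi:\mathrm{Aut}_{A+B_{\mathrm{tors}}}(B)\xrightarrow{\sim} \mathrm{Hom}(B/(A+B_{\mathrm{tors}}),B_{\mathrm{tors}}) \] which sends any $\sigma\in \mathrm{Aut}_{A+B_{\mathrm{tors}}}(B)$ to the group homomorphism $[b]\mapsto \sigma(b)-b$.
   Context: An $s$-extension of $A$ is an abelian group $B$ containing $A$ such that $B/A$ is torsion and $B_{\mathrm{tors}}$ (the torsion subgroup of $B$) is isomorphic to a subgroup of $(\mathbb{Q}/\mathbb{Z})^s$. $\mathrm{Aut}_X(B)$ denotes the group of automorphisms of $B$ restricting to the identity on the subgroup $X$. -}

module Defs where

open import Level using (Level; _⊔_)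
open import Algebra.Bundles using (AbelianGroup)
open import Data.Nat as ℕ using (ℕ; NonZero)
open import Data.Integer as ℤ using (ℤ; +_; -[1+_])
open import Data.Fin using (Fin)
open import Data.Product using (Σ; ∃; ∃-syntax; _×_; _,_; proj₁)
open import Data.Rational as ℚ using (ℚ)
open import Relation.Binary.PropositionalEquality using (_≡_)
import Algebra.Definitions.RawMonoid as RM

-- Q/Z: rationals modulo integers (x ~ y iff x - y is an integer,
-- i.e. its normalised denominator is 1).
_≈ℚ/ℤ_ : ℚ → ℚ → Set
x ≈ℚ/ℤ y = ℚ.denominatorℕ (x ℚ.- y) ≡ 1

_≈ℚ/ℤ^_ : {s : ℕ} → (Fin s → ℚ) → (Fin s → ℚ) → Set
u ≈ℚ/ℤ^ v = ∀ i → u i ≈ℚ/ℤ v i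

module _ {c ℓ} (G : AbelianGroup c ℓ) where
  open AbelianGroup G renaming (Carrier to B)
  open RM rawMonoid using (sum) renaming (_×_ to _·ℕ_)

  _·ℤ_ : ℤ → B → B
  (+ n) ·ℤ x = n ·ℕ x
  -[1+ n ] ·ℤ x = (ℕ.suc n ·ℕ x) ⁻¹

  record IsSubgroup {p} (P : B → Set p) : Set (c ⊔ ℓ ⊔ p) where
    field
      resp  : ∀ {x y} → x ≈ y → P x → P y
      has-ε : P ε
      ∙-closed : ∀ {x y} → P x → P y → P (x ∙ y)
      ⁻¹-closed : ∀ {x} → P x → P (x ⁻¹)

  IsFinitelyGenerated : ∀ {p} → (B → Set p) → Set (c ⊔ ℓ ⊔ p)
  IsFinitelyGenerated P =
    ∃[ n ] Σ (Fin n → B) λ gens → (∀ i → P (gens i)) ×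
      (∀ x → P x → Σ (Fin n → ℤ) λ k → (x ≈ sum (λ i → k i ·ℤ gens i)))

  IsTorsion : B → Set ℓ
  IsTorsion x = ∃[ n ] (NonZero n × (n ·ℕ x ≈ ε))

  -- G / P is torsion
  IsTorsionOver : ∀ {p} → (B → Set p) → Set (c ⊔ p)
  IsTorsionOver P = ∀ x → ∃[ n ] (NonZero n × P (n ·ℕ x))

  -- G_tors is isomorphic to a subgroup of (Q/Z)^s: there is a map
  -- f whose restriction to G_tors is an injective group homomorphism
  -- into (Q/Z)^s (values outside G_tors are irrelevant).
  TorsionEmbedsIn : ℕ → Set (c ⊔ ℓ)
  TorsionEmbedsIn s = Σ (B → (Fin s → ℚ)) λ f →
      (∀ x y → IsTorsion x → IsTorsion y → f x ≈ℚ/ℤ^ f y → x ≈ y)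
    × (∀ x y → IsTorsion x → IsTorsion y → x ≈ y → f x ≈ℚ/ℤ^ f y)
    × (∀ x y → IsTorsion x → IsTorsion y →
         f (x ∙ y) ≈ℚ/ℤ^ (λ i → f x i ℚ.+ f y i))

  record IsSExtension {p} (s : ℕ) (A : B → Set p) : Set (c ⊔ ℓ ⊔ p) where
    field
      subgroup : IsSubgroup A
      torsionQuotient : IsTorsionOver A
      torsionEmbeds : TorsionEmbedsIn s

  PlusTorsion : ∀ {p} → (B → Set p) → B → Set (c ⊔ ℓ ⊔ p)
  PlusTorsion A x = ∃[ a ] ∃[ t ] (A a × IsTorsion t × x ≈ a ∙ t)

  record IsAutFixing {p} (X : B → Set p) (σ : B → B) : Set (c ⊔ ℓ ⊔ p) where
    field
      cong-σ : ∀ {x y} → x ≈ y → σ x ≈ σ y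
      hom    : ∀ x y → σ (x ∙ y) ≈ σ x ∙ σ y
      inverse : Σ (B → B) λ τ → (∀ x → σ (τ x) ≈ x) × (∀ x → τ (σ x) ≈ x)
      fixes  : ∀ x → X x → σ x ≈ x

  -- g : G → G represents an element of Hom(G/X, G_tors):
  -- a homomorphism, constant on X-cosets, with values in G_tors.
  record IsQuotHomToTorsion {p} (X : B → Set p) (g : B → B) : Set (c ⊔ ℓ ⊔ p) where
    field
      torsion-valued : ∀ x → IsTorsion (g x)
      coset-invariant : ∀ x y → X (x ∙ y ⁻¹) → g x ≈ g y
      hom : ∀ x y → g (x ∙ y) ≈ g x ∙ g y

  φ : (B → B) → (B → B)
  φ σ b = σ b ∙ b ⁻¹

  -- φ is an isomorphism Aut_X(G) ≅ Hom(G/X, G_tors), groups with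
  -- composition resp. pointwise addition, equality pointwise.
  record IsCanonicalIso {p} (X : B → Set p) : Set (c ⊔ ℓ ⊔ p) where
    field
      well-defined : ∀ σ → IsAutFixing X σ → IsQuotHomToTorsion X (φ σ)
      respects-≈ : ∀ σ τ → IsAutFixing X σ → IsAutFixing X τ →
        (∀ b → σ b ≈ τ b) → ∀ b → φ σ b ≈ φ τ b
      homomorphism : ∀ σ τ → IsAutFixing X σ → IsAutFixing X τ →
        ∀ b → φ (λ x → σ (τ x)) b ≈ φ σ b ∙ φ τ b
      injective : ∀ σ τ → IsAutFixing X σ → IsAutFixing X τ →
        (∀ b → φ σ b ≈ φ τ b) → ∀ b → σ b ≈ τ b
      surjective : ∀ g → IsQuotHomToTorsion X g →
        Σ (B → B) λ σ → IsAutFixing X σ × (∀ b → φ σ b ≈ g b)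

-- Let X = A + B_tors. For σ fixing X, b ↦ σ b - b is additive, kills X, and is torsion-valued since
-- n b ∈ A ⊆ X for some n ≠ 0; it determines σ, and composition becomes addition because σ fixes the
-- torsion values of τ b - b. Conversely a homomorphism g : B/X → B_tors has g ∘ g = 0 (as B_tors ⊆ X),
-- so b ↦ b + g b is an automorphism fixing X, with inverse b ↦ b - g b.
module Submission where

open import Defs
open import Algebra.Bundles using (AbelianGroup)
open import Data.Nat using (ℕ; NonZero; zero; suc)
open import Data.Product using (Σ; _×_; _,_)
import Algebra.Definitions.RawMonoid as RawMonoidDefinitions
import Algebra.Properties.AbelianGroup as AbelianGroupProperties
import Algebra.Properties.CommutativeSemigroup as CommutativeSemigroupProperties
import Relation.Binary.Reasoning.Setoid as SetoidReasoning

module _ {c ℓ} (G : AbelianGroup c ℓ) where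
  open AbelianGroup G renaming (Carrier to B)
  open RawMonoidDefinitions rawMonoid using () renaming (_×_ to _·_)
  open AbelianGroupProperties G
  open CommutativeSemigroupProperties commutativeSemigroup
    using (interchange; xy∙z≈xz∙y; xy∙z≈y∙xz)
  open SetoidReasoning setoid

  module Endomorphism {h : B → B} (h-cong : ∀ {x y} → x ≈ y → h x ≈ h y)
                      (h-∙ : ∀ x y → h (x ∙ y) ≈ h x ∙ h y) where

    ε-homo : h ε ≈ ε
    ε-homo = identityʳ-unique (h ε) (h ε) (trans (sym (h-∙ ε ε)) (h-cong (identityˡ ε)))

    ·-homo : ∀ n x → h (n · x) ≈ n · h x
    ·-homo zero    x = ε-homo
    ·-homo (suc n) x = trans (h-∙ x (n · x)) (∙-congˡ (·-homo n x))

    ⁻¹-homo : ∀ x → h (x ⁻¹) ≈ h x ⁻¹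
    ⁻¹-homo x = inverseʳ-unique (h x) (h (x ⁻¹))
      (trans (sym (h-∙ x (x ⁻¹))) (trans (h-cong (inverseʳ x)) ε-homo))

    vanishing⇒coset-invariant : ∀ {p} {X : B → Set p} → (∀ x → X x → h x ≈ ε) →
                                ∀ x y → X (x - y) → h x ≈ h y
    vanishing⇒coset-invariant vanishes x y x-y∈X = begin
      h x             ≈⟨ h-cong (//-rightDividesˡ y x) ⟨
      h ((x - y) ∙ y) ≈⟨ h-∙ (x - y) y ⟩
      h (x - y) ∙ h y ≈⟨ ∙-congʳ (vanishes (x - y) x-y∈X) ⟩
      ε ∙ h y         ≈⟨ identityˡ (h y) ⟩
      h y             ∎

  φ-injective : ∀ σ τ → (∀ b → φ G σ b ≈ φ G τ b) → ∀ b → σ b ≈ τ b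
  φ-injective σ τ φσ≈φτ b = begin
    σ b           ≈⟨ //-rightDividesˡ b (σ b) ⟨
    (σ b - b) ∙ b ≈⟨ ∙-congʳ (φσ≈φτ b) ⟩
    (τ b - b) ∙ b ≈⟨ //-rightDividesˡ b (τ b) ⟩
    τ b           ∎

  module Automorphism {p} {X : B → Set p} {σ : B → B} (aut : IsAutFixing G X σ) where
    open IsAutFixing aut

    φ-cong : ∀ {x y} → x ≈ y → φ G σ x ≈ φ G σ y
    φ-cong x≈y = ∙-cong (cong-σ x≈y) (⁻¹-cong x≈y)

    φ-∙ : ∀ x y → φ G σ (x ∙ y) ≈ φ G σ x ∙ φ G σ y
    φ-∙ x y = begin
      σ (x ∙ y) - (x ∙ y)         ≈⟨ ∙-cong (hom x y) (sym (⁻¹-∙-comm x y)) ⟩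
      (σ x ∙ σ y) ∙ (x ⁻¹ ∙ y ⁻¹) ≈⟨ interchange (σ x) (σ y) (x ⁻¹) (y ⁻¹) ⟩
      (σ x - x) ∙ (σ y - y)       ∎

    φ-vanishes : ∀ x → X x → φ G σ x ≈ ε
    φ-vanishes x x∈X = trans (∙-congʳ (fixes x x∈X)) (inverseʳ x)

    open Endomorphism φ-cong φ-∙ using (·-homo; vanishing⇒coset-invariant)

    φ-torsion-valued : IsTorsionOver G X → ∀ b → IsTorsion G (φ G σ b)
    φ-torsion-valued torsionOver b with torsionOver b
    ... | n , n≢0 , nb∈X = n , n≢0 , trans (sym (·-homo n b)) (φ-vanishes (n · b) nb∈X)

    φ-isQuotHomToTorsion : IsTorsionOver G X → IsQuotHomToTorsion G X (φ G σ)
    φ-isQuotHomToTorsion torsionOver = record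
      { torsion-valued  = φ-torsion-valued torsionOver
      ; coset-invariant = vanishing⇒coset-invariant φ-vanishes
      ; hom             = φ-∙
      }

    φ-∘ : ∀ τ b → X (φ G τ b) → φ G (λ x → σ (τ x)) b ≈ φ G σ b ∙ φ G τ b
    φ-∘ τ b t∈X = begin
      σ (τ b) - b       ≈⟨ ∙-congʳ (cong-σ (trans (comm b t) (//-rightDividesˡ b (τ b)))) ⟨
      σ (b ∙ t) - b     ≈⟨ ∙-congʳ (hom b t) ⟩
      (σ b ∙ σ t) - b   ≈⟨ ∙-congʳ (∙-congˡ (fixes t t∈X)) ⟩
      (σ b ∙ t) - b     ≈⟨ xy∙z≈xz∙y (σ b) t (b ⁻¹) ⟩
      (σ b - b) ∙ t     ∎
      where t = τ b - b

  module SquareZero {g : B → B} (g-cong : ∀ {x y} → x ≈ y → g x ≈ g y)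
                    (g-∙ : ∀ x y → g (x ∙ y) ≈ g x ∙ g y)
                    (g∘g≈ε : ∀ x → g (g x) ≈ ε) where
    open Endomorphism g-cong g-∙ using (⁻¹-homo)

    id+g : B → B
    id+g x = x ∙ g x

    id-g : B → B
    id-g x = x - g x

    id+g∘id-g : ∀ x → id+g (id-g x) ≈ x
    id+g∘id-g x = begin
      (x - g x) ∙ g (x - g x)         ≈⟨ ∙-congˡ (g-∙ x (g x ⁻¹)) ⟩
      (x - g x) ∙ (g x ∙ g (g x ⁻¹))  ≈⟨ ∙-congˡ (∙-congˡ g∘g⁻¹≈ε) ⟩
      (x - g x) ∙ (g x ∙ ε)           ≈⟨ ∙-congˡ (identityʳ (g x)) ⟩
      (x - g x) ∙ g x                 ≈⟨ //-rightDividesˡ (g x) x ⟩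
      x                               ∎
      where
      g∘g⁻¹≈ε : g (g x ⁻¹) ≈ ε
      g∘g⁻¹≈ε = trans (⁻¹-homo (g x)) (trans (⁻¹-cong (g∘g≈ε x)) ε⁻¹≈ε)

    id-g∘id+g : ∀ x → id-g (id+g x) ≈ x
    id-g∘id+g x = begin
      (x ∙ g x) - g (x ∙ g x)       ≈⟨ ∙-congˡ (⁻¹-cong (g-∙ x (g x))) ⟩
      (x ∙ g x) - (g x ∙ g (g x))   ≈⟨ ∙-congˡ (⁻¹-cong (trans (∙-congˡ (g∘g≈ε x)) (identityʳ (g x)))) ⟩
      (x ∙ g x) - g x               ≈⟨ //-rightDividesʳ (g x) x ⟩
      x                             ∎

    id+g-isAutFixing : ∀ {p} {X : B → Set p} → (∀ x → X x → g x ≈ ε) → IsAutFixing G X id+g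
    id+g-isAutFixing vanishes = record
      { cong-σ  = λ x≈y → ∙-cong x≈y (g-cong x≈y)
      ; hom     = λ x y → trans (∙-congˡ (g-∙ x y)) (interchange x y (g x) (g y))
      ; inverse = id-g , id+g∘id-g , id-g∘id+g
      ; fixes   = λ x x∈X → trans (∙-congˡ (vanishes x x∈X)) (identityʳ x)
      }

    φ-id+g : ∀ b → φ G id+g b ≈ g b
    φ-id+g b = trans (xy∙z≈y∙xz b (g b) (b ⁻¹)) (trans (∙-congˡ (inverseʳ b)) (identityʳ (g b)))

  ε-torsion : IsTorsion G ε
  ε-torsion = 1 , _ , identityˡ ε

  module _ {p} {X : B → Set p}
           (X-resp : ∀ {x y} → x ≈ y → X y → X x)
           (torsion⊆X : ∀ {t} → IsTorsion G t → X t) where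

    module QuotHomToTorsion {g : B → B} (isHom : IsQuotHomToTorsion G X g) where
      open IsQuotHomToTorsion isHom

      g-cong : ∀ {x y} → x ≈ y → g x ≈ g y
      g-cong {x} {y} x≈y = coset-invariant x y (X-resp (x≈y⇒x∙y⁻¹≈ε x≈y) (torsion⊆X ε-torsion))

      open Endomorphism g-cong hom using (ε-homo)

      g-vanishes : ∀ x → X x → g x ≈ ε
      g-vanishes x x∈X = trans (coset-invariant x ε (X-resp (trans (∙-congˡ ε⁻¹≈ε) (identityʳ x)) x∈X)) ε-homo

      g∘g≈ε : ∀ x → g (g x) ≈ ε
      g∘g≈ε x = g-vanishes (g x) (torsion⊆X (torsion-valued x))

      open SquareZero g-cong hom g∘g≈ε public using (id+g; id+g-isAutFixing; φ-id+g)

    φ-surjective : ∀ g → IsQuotHomToTorsion G X g →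
                   Σ (B → B) λ σ → IsAutFixing G X σ × (∀ b → φ G σ b ≈ g b)
    φ-surjective g isHom = id+g , id+g-isAutFixing g-vanishes , φ-id+g
      where open QuotHomToTorsion isHom

    φ-isCanonicalIso : IsTorsionOver G X → IsCanonicalIso G X
    φ-isCanonicalIso torsionOver = record
      { well-defined = λ σ aut → Automorphism.φ-isQuotHomToTorsion aut torsionOver
      ; respects-≈   = λ σ τ _ _ σ≈τ b → ∙-congʳ (σ≈τ b)
      ; homomorphism = λ σ τ σ-aut τ-aut b →
          Automorphism.φ-∘ σ-aut τ b (torsion⊆X (Automorphism.φ-torsion-valued τ-aut torsionOver b))
      ; injective    = λ σ τ _ _ → φ-injective σ τ
      ; surjective   = φ-surjective
      }

  module _ {p} {A : B → Set p} where

    PlusTorsion-resp : ∀ {x y} → x ≈ y → PlusTorsion G A y → PlusTorsion G A x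
    PlusTorsion-resp x≈y (a , t , a∈A , t-torsion , y≈a∙t) = a , t , a∈A , t-torsion , trans x≈y y≈a∙t

    torsion⊆PlusTorsion : IsSubgroup G A → ∀ {t} → IsTorsion G t → PlusTorsion G A t
    torsion⊆PlusTorsion A-subgroup {t} t-torsion =
      ε , t , IsSubgroup.has-ε A-subgroup , t-torsion , sym (identityˡ t)

    torsionOver-PlusTorsion : IsTorsionOver G A → IsTorsionOver G (PlusTorsion G A)
    torsionOver-PlusTorsion torsionOver b with torsionOver b
    ... | n , n≢0 , nb∈A = n , n≢0 , (n · b , ε , nb∈A , ε-torsion , sym (identityʳ (n · b)))

proposition3p11 : ∀ {c ℓ p} (s : ℕ) → NonZero s →
    (B : AbelianGroup c ℓ) (A : AbelianGroup.Carrier B → Set p) →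
    IsFinitelyGenerated B A → IsSExtension B s A →
    IsCanonicalIso B (PlusTorsion B A)
proposition3p11 s _ B A _ extension =
  φ-isCanonicalIso B (PlusTorsion-resp B) (torsion⊆PlusTorsion B subgroup)
    (torsionOver-PlusTorsion B torsionQuotient)
  where open IsSExtension extension
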